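{- Let $G\in\mathcal{S}$. Then $\chi'_o(G)=2$ if and only if $G$ is not odd and for every cycle $C$ of $G$ the set $\{v\in V(C): d_G(v)=2\}$ has even size.
   Context: Graphs are finite and may have loops and parallel edges; degrees $d_G(v)$ count loops twice. Cycles include loops and $2$-cycles formed by parallel edges. A graph is odd if all its degrees are odd. $\mathcal{S}$ is the class of graphs obtainable from an odd graph by subdividing edges (replacing edges by paths). An odd edge-coloring of $G$ is a coloring of the edges such that for every color $c$ and every vertex $w$ incident with an edge of color $c$, the number of edges of color $c$ at $w$ (loops counted twice) is odd; $\chi'_o(G)$ is the minimum number of colors of such a coloring. -}

module Defs where

open import Data.Nat using (ℕ; zero; suc; _+_; _<_; _%_)
open import Data.Nat.DivMod using (m%n<n)
open import Data.Nat.Divisibility using (_∣_)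
open import Data.Fin using (Fin; zero; suc; toℕ; fromℕ<; _≟_)
open import Data.Product using (Σ; _×_; _,_; proj₁; proj₂)
open import Data.Sum using (_⊎_)
open import Data.Bool using (Bool; true; false; if_then_else_)
open import Relation.Nullary using (¬_; Dec; yes; no)
open import Relation.Nullary.Decidable using (⌊_⌋)
open import Relation.Binary.PropositionalEquality using (_≡_)
open import Function.Definitions using (Injective)
open import Function.Bundles using (_↔_; Inverse)

-- Finite multigraphs with loops and parallel edges.
-- Vertices are Fin nV, edges are Fin nE, each edge has two ends
-- (a loop is an edge whose two ends coincide).

record Graph : Set where
  field
    nV   : ℕ
    nE   : ℕ
    ends : Fin nE → Fin nV × Fin nV
open Graph public

sumFin : ∀ {n} → (Fin n → ℕ) → ℕ
sumFin {zero}  f = 0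
sumFin {suc n} f = f zero + sumFin (λ i → f (suc i))

[_≡ᵛ_] : ∀ {n} → Fin n → Fin n → ℕ
[ u ≡ᵛ v ] = if ⌊ u ≟ v ⌋ then 1 else 0

-- number of ends of edge e at v (2 for a loop at v)
endsAt : (G : Graph) → Fin (nE G) → Fin (nV G) → ℕ
endsAt G e v = [ proj₁ (ends G e) ≡ᵛ v ] + [ proj₂ (ends G e) ≡ᵛ v ]

deg : (G : Graph) → Fin (nV G) → ℕ
deg G v = sumFin (λ e → endsAt G e v)

Even : ℕ → Set
Even n = 2 ∣ n

Odd : ℕ → Set
Odd n = ¬ (2 ∣ n)

IsOdd : Graph → Set
IsOdd G = (v : Fin (nV G)) → Odd (deg G v)

Joins : (G : Graph) → Fin (nE G) → Fin (nV G) → Fin (nV G) → Set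
Joins G e u w = (ends G e ≡ (u , w)) ⊎ (ends G e ≡ (w , u))

record Iso (G H : Graph) : Set where
  field
    vmap  : Fin (nV G) ↔ Fin (nV H)
    emap  : Fin (nE G) ↔ Fin (nE H)
    preserves : (e : Fin (nE G)) →
      Joins H (Inverse.to emap e)
              (Inverse.to vmap (proj₁ (ends G e)))
              (Inverse.to vmap (proj₂ (ends G e)))

-- Subdivision of a single edge e = (a,b): a new vertex x (index zero,
-- old vertices shifted by suc) is inserted; edge e becomes (a,x) and a
-- new edge (x,b) (index zero, old edges shifted by suc) is added.

subdivide : (G : Graph) → Fin (nE G) → Graph
subdivide G e = record
  { nV   = suc (nV G)
  ; nE   = suc (nE G)
  ; ends = ends′
  }
  where
  ends′ : Fin (suc (nE G)) → Fin (suc (nV G)) × Fin (suc (nV G))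
  ends′ zero = (zero , suc (proj₂ (ends G e)))
  ends′ (suc f) with f ≟ e
  ... | yes _ = (suc (proj₁ (ends G e)) , zero)
  ... | no  _ = (suc (proj₁ (ends G f)) , suc (proj₂ (ends G f)))

-- G is obtained from H by a finite sequence of single-edge subdivisions
-- (equivalently: replacing edges of H by paths)
data SubdivOf (H : Graph) : Graph → Set where
  here : SubdivOf H H
  step : ∀ {G} → SubdivOf H G → (e : Fin (nE G)) → SubdivOf H (subdivide G e)

InS : Graph → Set
InS G = Σ Graph λ H → IsOdd H × Σ Graph λ G′ → SubdivOf H G′ × Iso G′ G

-- Cycles (including loops, k = 1, and 2-cycles of parallel edges, k = 2):
-- distinct vertices v₀ … v_{k-1}, distinct edges e₀ … e_{k-1},
-- e_i joining v_i and v_{i+1 mod k}.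

next : ∀ {k} → Fin (suc k) → Fin (suc k)
next {k} i = fromℕ< (m%n<n (suc (toℕ i)) (suc k))

record Cycle (G : Graph) : Set where
  field
    k     : ℕ                 -- the cycle has length suc k ≥ 1
    vs    : Fin (suc k) → Fin (nV G)
    es    : Fin (suc k) → Fin (nE G)
    vs-inj : Injective _≡_ _≡_ vs
    es-inj : Injective _≡_ _≡_ es
    joins : (i : Fin (suc k)) → Joins G (es i) (vs i) (vs (next i))

-- |{ v ∈ V(C) : d_G(v) = 2 }|  (vs is injective, so counting indices
-- counts vertices)
deg2Count : (G : Graph) → Cycle G → ℕ
deg2Count G C = sumFin (λ i → if ⌊ deg G (Cycle.vs C i) Data.Nat.≟ 2 ⌋ then 1 else 0)

colDeg : (G : Graph) {m : ℕ} → (Fin (nE G) → Fin m) → Fin m → Fin (nV G) → ℕ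
colDeg G col c w = sumFin (λ e → if ⌊ col e ≟ c ⌋ then endsAt G e w else 0)

IsOddColouring : (G : Graph) {m : ℕ} → (Fin (nE G) → Fin m) → Set
IsOddColouring G {m} col =
  (c : Fin m) (w : Fin (nV G)) → colDeg G col c w ≡ 0 ⊎ Odd (colDeg G col c w)

-- G has an odd edge-colouring with (at most) m colours
HasOddColouring : Graph → ℕ → Set
HasOddColouring G m = Σ (Fin (nE G) → Fin m) λ col → IsOddColouring G col

OddChromaticIndex : Graph → ℕ → Set
OddChromaticIndex G m = HasOddColouring G m × ((j : ℕ) → j < m → ¬ HasOddColouring G j)

-- Every graph in 𝒮 has all its degrees equal to 2 or odd, which is all the proof uses about 𝒮. In an odd
-- 2-edge-colouring the two edges at a vertex of degree 2 differ in colour while all edges at an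
-- odd vertex agree, so along a cycle the colour changes exactly at its degree-2 vertices, an
-- even number of times. Conversely, prescribe a colour change at each degree-2 vertex by
-- twisting one of its two edges there; the resulting edge labelling σ has a potential a
-- (a u xor a w = σ e on every edge e = uw) iff no cycle has odd σ-sum, i.e. iff every cycle
-- meets an even number of degree-2 vertices, and a potential reads off an odd 2-colouring.
-- One colour suffices for an odd graph, and a vertex of degree 2 needs two.

module Submission where

open import Defs
open import Algebra.Bundles using (CommutativeMonoid; CommutativeRing)
import Algebra.Properties.CommutativeMonoid.Sum as CommutativeMonoidSum
import Algebra.Properties.CommutativeSemigroup
open import Data.Bool using (Bool; true; false; if_then_else_; not; _xor_; _∨_; _∧_)
open import Data.Bool.Properties
  using (xor-∧-commutativeRing; xor-same; xor-comm; xor-assoc; xor-identityʳ;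
         not-involutive; not-distribˡ-xor; ∨-zeroʳ; ¬-not; xor-inverseˡ)
  renaming (_≟_ to _≟ᵇ_)
open import Data.Empty using (⊥; ⊥-elim)
open import Data.Fin using (Fin; zero; suc; toℕ; fromℕ; inject₁; _≟_)
open import Data.Fin.Properties using (toℕ-injective; toℕ-fromℕ<; toℕ-inject₁; toℕ-fromℕ; toℕ<n)
import Data.Fin.Properties as Finₚ
open import Data.Nat using (ℕ; zero; suc; _+_; _*_; _%_; _≤_; _<_; z≤n; s≤s)
import Data.Nat as ℕ
open import Data.Nat.DivMod using (m%n<n; m<n⇒m%n≡m; n%n≡0)
open import Data.Nat.Divisibility using (divides; _∣?_)
open import Data.Nat.Properties
  using (+-0-commutativeMonoid; _≤?_; +-comm; +-assoc; +-identityʳ; ≤-refl; ≤-trans;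
         ≤-antisym; +-mono-≤; m≤m+n; 1+n≢n; 1+n≢0; n≢0⇒n>0; suc-injective; m+1+n≢0)
open import Data.Product using (Σ; ∃; _×_; _,_; proj₁; proj₂)
open import Data.Sum using (_⊎_; inj₁; inj₂; [_,_]′)
open import Data.Vec.Functional using (tail)
open import Function.Bundles using (_⇔_; mk⇔; Inverse)
open import Function.Base using (id)
open import Function.Definitions using (Injective)
open import Relation.Nullary using (¬_; ¬?; Dec; yes; no)
open import Relation.Nullary.Decidable using (⌊_⌋; decidable-stable)
open import Relation.Binary.PropositionalEquality

module ℕSum = CommutativeMonoidSum +-0-commutativeMonoid
module XorSum = CommutativeMonoidSum (CommutativeRing.+-commutativeMonoid xor-∧-commutativeRing)

xorSum : ∀ {n} → (Fin n → Bool) → Bool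
xorSum = XorSum.sum

sumFin≡sum : ∀ {n} (f : Fin n → ℕ) → sumFin f ≡ ℕSum.sum f
sumFin≡sum {zero}  f = refl
sumFin≡sum {suc n} f = cong (f zero +_) (sumFin≡sum (λ i → f (suc i)))

sumFin-cong : ∀ {n} {f g : Fin n → ℕ} → (∀ i → f i ≡ g i) → sumFin f ≡ sumFin g
sumFin-cong {zero}  f≗g = refl
sumFin-cong {suc n} f≗g = cong₂ _+_ (f≗g zero) (sumFin-cong (λ i → f≗g (suc i)))

sumFin-+ : ∀ {n} (f g : Fin n → ℕ) → sumFin (λ i → f i + g i) ≡ sumFin f + sumFin g
sumFin-+ f g = begin
  sumFin (λ i → f i + g i)       ≡⟨ sumFin≡sum (λ i → f i + g i) ⟩
  ℕSum.sum (λ i → f i + g i)     ≡⟨ ℕSum.∑-distrib-+ f g ⟩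
  ℕSum.sum f + ℕSum.sum g        ≡⟨ sym (cong₂ _+_ (sumFin≡sum f) (sumFin≡sum g)) ⟩
  sumFin f + sumFin g            ∎
  where open ≡-Reasoning

sumFin-zero : ∀ {n} {f : Fin n → ℕ} → (∀ i → f i ≡ 0) → sumFin f ≡ 0
sumFin-zero {zero}  f≗0 = refl
sumFin-zero {suc n} f≗0 = cong₂ _+_ (f≗0 zero) (sumFin-zero (λ i → f≗0 (suc i)))

sumFin-mono : ∀ {n} {f g : Fin n → ℕ} → (∀ i → f i ≤ g i) → sumFin f ≤ sumFin g
sumFin-mono {zero}  f≤g = z≤n
sumFin-mono {suc n} f≤g = +-mono-≤ (f≤g zero) (sumFin-mono (λ i → f≤g (suc i)))

sumFin-nonzero : ∀ {n} (f : Fin n → ℕ) → sumFin f ≢ 0 → ∃ λ i → f i ≢ 0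
sumFin-nonzero {zero}  f ∑f≢0 = ⊥-elim (∑f≢0 refl)
sumFin-nonzero {suc n} f ∑f≢0 with f zero in f₀≡
... | suc _ = zero , λ f₀≡0 → 1+n≢0 (trans (sym f₀≡) f₀≡0)
... | zero  = let i , fᵢ≢0 = sumFin-nonzero (λ i → f (suc i)) ∑f≢0 in suc i , fᵢ≢0

zeroAt : ∀ {n} → Fin n → (Fin n → ℕ) → Fin n → ℕ
zeroAt i f x = if ⌊ x ≟ i ⌋ then 0 else f x

zeroAt-≢ : ∀ {n} {i x : Fin n} (f : Fin n → ℕ) → x ≢ i → zeroAt i f x ≡ f x
zeroAt-≢ {i = i} {x} f x≢i with x ≟ i
... | yes x≡i = ⊥-elim (x≢i x≡i)
... | no  _   = refl

zeroAt-self : ∀ {n} (i : Fin n) (f : Fin n → ℕ) → zeroAt i f i ≡ 0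
zeroAt-self i f with i ≟ i
... | yes _   = refl
... | no  i≢i = ⊥-elim (i≢i refl)

zeroAt-cong : ∀ {n} (i : Fin n) {f g : Fin n → ℕ} → (∀ x → x ≢ i → f x ≡ g x) →
              ∀ x → zeroAt i f x ≡ zeroAt i g x
zeroAt-cong i f≗g x with x ≟ i
... | yes _   = refl
... | no  x≢i = f≗g x x≢i

sumFin-pick : ∀ {n} (i : Fin n) (f : Fin n → ℕ) → sumFin f ≡ f i + sumFin (zeroAt i f)
sumFin-pick zero    f = refl
sumFin-pick (suc i) f = begin
  f zero + sumFin (tail f)                                  ≡⟨ cong (f zero +_) (sumFin-pick i (tail f)) ⟩
  f zero + (f (suc i) + sumFin (zeroAt i (tail f)))         ≡⟨ sym (+-assoc (f zero) _ _) ⟩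
  (f zero + f (suc i)) + sumFin (zeroAt i (tail f))         ≡⟨ cong (_+ sumFin (zeroAt i (tail f))) (+-comm (f zero) _) ⟩
  (f (suc i) + f zero) + sumFin (zeroAt i (tail f))         ≡⟨ +-assoc (f (suc i)) _ _ ⟩
  f (suc i) + (f zero + sumFin (zeroAt i (tail f)))         ≡⟨ cong (λ s → f (suc i) + (f zero + s)) (sumFin-cong shift) ⟩
  f (suc i) + sumFin (zeroAt (suc i) f)                     ∎
  where
  open ≡-Reasoning
  shift : ∀ x → zeroAt i (tail f) x ≡ zeroAt (suc i) f (suc x)
  shift x with x ≟ i
  ... | yes _ = refl
  ... | no  _ = refl

[≡ᵛ]-suc : ∀ {n} (u v : Fin n) → [ suc u ≡ᵛ suc v ] ≡ [ u ≡ᵛ v ]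
[≡ᵛ]-suc u v with u ≟ v
... | yes _ = refl
... | no  _ = refl

[≡ᵛ]-≡ : ∀ {n} {u v : Fin n} → u ≡ v → [ u ≡ᵛ v ] ≡ 1
[≡ᵛ]-≡ {u = u} {v} u≡v with u ≟ v
... | yes _   = refl
... | no  u≢v = ⊥-elim (u≢v u≡v)

[≡ᵛ]-≢ : ∀ {n} {u v : Fin n} → u ≢ v → [ u ≡ᵛ v ] ≡ 0
[≡ᵛ]-≢ {u = u} {v} u≢v with u ≟ v
... | yes u≡v = ⊥-elim (u≢v u≡v)
... | no  _   = refl

sumFin-indicator : ∀ {n} (v : Fin n) → sumFin (λ x → [ x ≡ᵛ v ]) ≡ 1
sumFin-indicator v = trans (sumFin-pick v (λ x → [ x ≡ᵛ v ])) (cong₂ _+_ ([≡ᵛ]-≡ refl) (sumFin-zero off-v))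
  where
  off-v : ∀ x → zeroAt v (λ x → [ x ≡ᵛ v ]) x ≡ 0
  off-v x with x ≟ v
  ... | yes _ = refl
  ... | no  _ = refl

term≤sumFin : ∀ {n} (f : Fin n → ℕ) i → f i ≤ sumFin f
term≤sumFin f i = subst (f i ≤_) (sym (sumFin-pick i f)) (m≤m+n (f i) _)

two-terms≤sumFin : ∀ {n} (f : Fin n → ℕ) {i j} → i ≢ j → f i + f j ≤ sumFin f
two-terms≤sumFin f {i} {j} i≢j = subst (f i + f j ≤_) (sym (sumFin-pick i f))
  (+-mono-≤ (≤-refl {f i})
    (subst (_≤ sumFin (zeroAt i f)) (zeroAt-≢ f (λ j≡i → i≢j (sym j≡i))) (term≤sumFin (zeroAt i f) j)))

three-terms≤sumFin : ∀ {n} (f : Fin n → ℕ) {i j k} → i ≢ j → i ≢ k → j ≢ k →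
                     f i + (f j + f k) ≤ sumFin f
three-terms≤sumFin f {i} {j} {k} i≢j i≢k j≢k = subst (f i + (f j + f k) ≤_) (sym (sumFin-pick i f))
  (+-mono-≤ (≤-refl {f i})
    (subst₂ (λ a b → a + b ≤ sumFin (zeroAt i f))
      (zeroAt-≢ f (λ j≡i → i≢j (sym j≡i))) (zeroAt-≢ f (λ k≡i → i≢k (sym k≡i)))
      (two-terms≤sumFin (zeroAt i f) j≢k)))

true≢false : true ≢ false
true≢false ()

parity : ℕ → Bool
parity zero    = false
parity (suc n) = not (parity n)

parity-+ : ∀ m n → parity (m + n) ≡ parity m xor parity n
parity-+ zero    n = refl
parity-+ (suc m) n = trans (cong not (parity-+ m n)) (not-distribˡ-xor (parity m) (parity n))

even⇒parity≡false : ∀ {n} → Even n → parity n ≡ false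
even⇒parity≡false (divides q refl) = parity-double q
  where
  parity-double : ∀ q → parity (q * 2) ≡ false
  parity-double zero    = refl
  parity-double (suc q) = trans (not-involutive (parity (q * 2))) (parity-double q)

parity≡false⇒even : ∀ n → parity n ≡ false → Even n
parity≡false⇒even zero          _ = divides 0 refl
parity≡false⇒even (suc (suc n)) p with parity≡false⇒even n (trans (sym (not-involutive (parity n))) p)
... | divides q n≡q*2 = divides (suc q) (cong (λ m → suc (suc m)) n≡q*2)

odd⇒parity≡true : ∀ {n} → Odd n → parity n ≡ true
odd⇒parity≡true {n} odd with parity n in p
... | true  = refl
... | false = ⊥-elim (odd (parity≡false⇒even n p))

parity≡true⇒odd : ∀ {n} → parity n ≡ true → Odd n
parity≡true⇒odd p even with trans (sym p) (even⇒parity≡false even)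
... | ()

¬Odd-2 : ¬ Odd 2
¬Odd-2 odd = odd (divides 1 refl)

parity-sumFin-indicator : ∀ {n} (b : Fin n → Bool) → parity (sumFin (λ i → if b i then 1 else 0)) ≡ xorSum b
parity-sumFin-indicator {zero}  b = refl
parity-sumFin-indicator {suc n} b =
  trans (parity-+ (if b zero then 1 else 0) _)
        (cong₂ _xor_ (parity-indicator (b zero)) (parity-sumFin-indicator (tail b)))
  where
  parity-indicator : ∀ x → parity (if x then 1 else 0) ≡ x
  parity-indicator true  = refl
  parity-indicator false = refl

data InitOrLast {k : ℕ} : Fin (suc k) → Set where
  init : (j : Fin k) → InitOrLast (inject₁ j)
  last : InitOrLast (fromℕ k)

initOrLast : ∀ {k} (i : Fin (suc k)) → InitOrLast i
initOrLast {zero}  zero    = last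
initOrLast {suc k} zero    = init zero
initOrLast {suc k} (suc i) with initOrLast i
... | init j = init (suc j)
... | last   = last

next-inject₁ : ∀ {k} (j : Fin k) → next (inject₁ j) ≡ suc j
next-inject₁ {k} j = toℕ-injective (begin
  toℕ (next (inject₁ j))       ≡⟨ toℕ-fromℕ< (m%n<n (suc (toℕ (inject₁ j))) (suc k)) ⟩
  suc (toℕ (inject₁ j)) % suc k ≡⟨ cong (λ x → suc x % suc k) (toℕ-inject₁ j) ⟩
  suc (toℕ j) % suc k           ≡⟨ m<n⇒m%n≡m (s≤s (toℕ<n j)) ⟩
  suc (toℕ j)                   ∎)
  where open ≡-Reasoning

next-fromℕ : ∀ k → next (fromℕ k) ≡ zero
next-fromℕ k = toℕ-injective (begin
  toℕ (next (fromℕ k))          ≡⟨ toℕ-fromℕ< (m%n<n (suc (toℕ (fromℕ k))) (suc k)) ⟩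
  suc (toℕ (fromℕ k)) % suc k   ≡⟨ cong (λ x → suc x % suc k) (toℕ-fromℕ k) ⟩
  suc k % suc k                 ≡⟨ n%n≡0 (suc k) ⟩
  0                             ∎)
  where open ≡-Reasoning

next-≢ : ∀ {k} (i : Fin (suc (suc k))) → next i ≢ i
next-≢ i next-i≡i with initOrLast i
... | init j = 1+n≢n (begin
  suc (toℕ j)            ≡⟨ cong toℕ (sym (next-inject₁ j)) ⟩
  toℕ (next (inject₁ j)) ≡⟨ cong toℕ next-i≡i ⟩
  toℕ (inject₁ j)        ≡⟨ toℕ-inject₁ j ⟩
  toℕ j                  ∎)
  where open ≡-Reasoning
... | last with trans (sym (next-fromℕ _)) next-i≡i
...   | ()

xorSum-cong : ∀ {n} {f g : Fin n → Bool} → (∀ i → f i ≡ g i) → xorSum f ≡ xorSum g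
xorSum-cong = XorSum.sum-cong-≗

xorSum-next : ∀ {k} (h : Fin (suc k) → Bool) → xorSum (λ i → h (next i)) ≡ xorSum h
xorSum-next {k} h = begin
  xorSum (λ i → h (next i))                                  ≡⟨ XorSum.sum-init-last (λ i → h (next i)) ⟩
  xorSum (λ j → h (next (inject₁ j))) xor h (next (fromℕ k)) ≡⟨ cong₂ _xor_ (xorSum-cong (λ j → cong h (next-inject₁ j)))
                                                                              (cong h (next-fromℕ k)) ⟩
  xorSum (tail h) xor h zero                                 ≡⟨ xor-comm _ (h zero) ⟩
  xorSum h                                                   ∎
  where open ≡-Reasoning

-- The changes a i ↦ b i ↦ a (next i) telescope around a cycle.
xorSum-around : ∀ {k} (a b d : Fin (suc k) → Bool) → (∀ i → b i xor a (next i) ≡ d (next i)) →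
                xorSum (λ i → a i xor b i) ≡ xorSum d
xorSum-around a b d switch = begin
  xorSum (λ i → a i xor b i)                ≡⟨ XorSum.∑-distrib-+ a b ⟩
  xorSum a xor xorSum b                     ≡⟨ cong (_xor xorSum b) (sym (xorSum-next a)) ⟩
  xorSum (λ i → a (next i)) xor xorSum b    ≡⟨ xor-comm _ (xorSum b) ⟩
  xorSum b xor xorSum (λ i → a (next i))    ≡⟨ sym (XorSum.∑-distrib-+ b (λ i → a (next i))) ⟩
  xorSum (λ i → b i xor a (next i))         ≡⟨ xorSum-cong switch ⟩
  xorSum (λ i → d (next i))                 ≡⟨ xorSum-next d ⟩
  xorSum d                                  ∎
  where open ≡-Reasoning

src tgt : (G : Graph) → Fin (nE G) → Fin (nV G)
src G e = proj₁ (ends G e)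
tgt G e = proj₂ (ends G e)

Incident : (G : Graph) → Fin (nE G) → Fin (nV G) → Set
Incident G e x = 1 ≤ endsAt G e x

module _ {G : Graph} where

  joins⇒incidentˡ : ∀ {e u w} → Joins G e u w → Incident G e u
  joins⇒incidentˡ {u = u} {w} (inj₁ ends≡) rewrite ends≡ | [≡ᵛ]-≡ {u = u} refl = s≤s z≤n
  joins⇒incidentˡ {u = u} {w} (inj₂ ends≡) rewrite ends≡ | [≡ᵛ]-≡ {u = u} refl | +-comm [ w ≡ᵛ u ] 1 = s≤s z≤n

  joins⇒incidentʳ : ∀ {e u w} → Joins G e u w → Incident G e w
  joins⇒incidentʳ (inj₁ ends≡) = joins⇒incidentˡ (inj₂ ends≡)
  joins⇒incidentʳ (inj₂ ends≡) = joins⇒incidentˡ (inj₁ ends≡)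

  joins-loop : ∀ {e u} → Joins G e u u → 2 ≤ endsAt G e u
  joins-loop {u = u} (inj₁ ends≡) rewrite ends≡ | [≡ᵛ]-≡ {u = u} refl = s≤s (s≤s z≤n)
  joins-loop {u = u} (inj₂ ends≡) rewrite ends≡ | [≡ᵛ]-≡ {u = u} refl = s≤s (s≤s z≤n)

  incident⇒endpoint : ∀ {e x} → Incident G e x → src G e ≡ x ⊎ tgt G e ≡ x
  incident⇒endpoint {e} {x} incident with src G e ≟ x | tgt G e ≟ x
  ... | yes src≡x | _         = inj₁ src≡x
  ... | no  _     | yes tgt≡x = inj₂ tgt≡x
  ... | no  _   | no  _   with incident
  ...   | ()

  xor-ends-joins : ∀ (h : Fin (nV G) → Bool) {e u w} → Joins G e u w → h (src G e) xor h (tgt G e) ≡ h u xor h w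
  xor-ends-joins h (inj₁ ends≡) = cong (λ uw → h (proj₁ uw) xor h (proj₂ uw)) ends≡
  xor-ends-joins h {u = u} {w} (inj₂ ends≡) =
    trans (cong (λ uw → h (proj₁ uw) xor h (proj₂ uw)) ends≡) (xor-comm (h w) (h u))

  joins-endpoints : ∀ {e u w a b} → Joins G e u w → Joins G e a b → u ≡ a ⊎ u ≡ b
  joins-endpoints (inj₁ e₁) (inj₁ e₂) = inj₁ (cong proj₁ (trans (sym e₁) e₂))
  joins-endpoints (inj₁ e₁) (inj₂ e₂) = inj₂ (cong proj₁ (trans (sym e₁) e₂))
  joins-endpoints (inj₂ e₁) (inj₁ e₂) = inj₂ (cong proj₂ (trans (sym e₁) e₂))
  joins-endpoints (inj₂ e₁) (inj₂ e₂) = inj₁ (cong proj₂ (trans (sym e₁) e₂))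

TwoOrOddDegrees : Graph → Set
TwoOrOddDegrees G = ∀ v → deg G v ≡ 2 ⊎ Odd (deg G v)

module _ (G : Graph) (e : Fin (nE G)) where
  private
    a = src G e
    b = tgt G e
    S = subdivide G e

  endsAt-subdivide-old : ∀ f v →
    endsAt S (suc f) (suc v) ≡ (if ⌊ f ≟ e ⌋ then [ a ≡ᵛ v ] else endsAt G f v)
  endsAt-subdivide-old f v with f ≟ e
  ... | yes refl = trans (cong (_+ 0) ([≡ᵛ]-suc a v)) (+-identityʳ _)
  ... | no  _    = cong₂ _+_ ([≡ᵛ]-suc (src G f) v) ([≡ᵛ]-suc (tgt G f) v)

  endsAt-subdivide-new : ∀ f → endsAt S (suc f) zero ≡ [ f ≡ᵛ e ]
  endsAt-subdivide-new f with f ≟ e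
  ... | yes refl = refl
  ... | no  _    = refl

  deg-subdivide-old : ∀ v → deg S (suc v) ≡ deg G v
  deg-subdivide-old v = begin
    deg S (suc v)                                     ≡⟨ cong₂ _+_ ([≡ᵛ]-suc b v) (sumFin-cong (λ f → endsAt-subdivide-old f v)) ⟩
    [ b ≡ᵛ v ] + sumFin new-ends                      ≡⟨ cong ([ b ≡ᵛ v ] +_) (sumFin-pick e new-ends) ⟩
    [ b ≡ᵛ v ] + (new-ends e + sumFin (zeroAt e new-ends)) ≡⟨ cong (λ x → [ b ≡ᵛ v ] + (x + sumFin (zeroAt e new-ends))) new-ends-e ⟩
    [ b ≡ᵛ v ] + ([ a ≡ᵛ v ] + sumFin (zeroAt e new-ends)) ≡⟨ sym (+-assoc [ b ≡ᵛ v ] _ _) ⟩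
    ([ b ≡ᵛ v ] + [ a ≡ᵛ v ]) + sumFin (zeroAt e new-ends) ≡⟨ cong₂ _+_ (+-comm [ b ≡ᵛ v ] _) (sumFin-cong (zeroAt-cong e same-off-e)) ⟩
    endsAt G e v + sumFin (zeroAt e old-ends)         ≡⟨ sym (sumFin-pick e old-ends) ⟩
    deg G v                                           ∎
    where
    open ≡-Reasoning
    new-ends old-ends : Fin (nE G) → ℕ
    new-ends f = if ⌊ f ≟ e ⌋ then [ a ≡ᵛ v ] else endsAt G f v
    old-ends f = endsAt G f v
    new-ends-e : new-ends e ≡ [ a ≡ᵛ v ]
    new-ends-e with e ≟ e
    ... | yes _   = refl
    ... | no  e≢e = ⊥-elim (e≢e refl)
    same-off-e : ∀ f → f ≢ e → new-ends f ≡ old-ends f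
    same-off-e f f≢e with f ≟ e
    ... | yes f≡e = ⊥-elim (f≢e f≡e)
    ... | no  _   = refl

  deg-subdivide-new : deg S zero ≡ 2
  deg-subdivide-new = cong (1 +_) (trans (sumFin-cong endsAt-subdivide-new) (sumFin-indicator e))

subdivision-degrees : ∀ {H G} → IsOdd H → SubdivOf H G → TwoOrOddDegrees G
subdivision-degrees H-odd here             v       = inj₂ (H-odd v)
subdivision-degrees H-odd (step {G} sub e) zero    = inj₁ (deg-subdivide-new G e)
subdivision-degrees H-odd (step {G} sub e) (suc v) rewrite deg-subdivide-old G e v = subdivision-degrees H-odd sub v

module _ {G H : Graph} (iso : Iso G H) where
  open Iso iso
  private
    module V = Inverse vmap
    module E = Inverse emap

  [≡ᵛ]-iso : ∀ u v → [ V.to u ≡ᵛ V.to v ] ≡ [ u ≡ᵛ v ]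
  [≡ᵛ]-iso u v with u ≟ v
  ... | yes refl = [≡ᵛ]-≡ refl
  ... | no  u≢v  = [≡ᵛ]-≢ (λ to-u≡to-v → u≢v (trans (sym (V.inverseʳ refl)) (V.inverseʳ to-u≡to-v)))

  endsAt-iso : ∀ f v → endsAt H (E.to f) (V.to v) ≡ endsAt G f v
  endsAt-iso f v with preserves f
  ... | inj₁ ends≡ rewrite ends≡ = cong₂ _+_ ([≡ᵛ]-iso (src G f) v) ([≡ᵛ]-iso (tgt G f) v)
  ... | inj₂ ends≡ rewrite ends≡ =
    trans (+-comm [ V.to (tgt G f) ≡ᵛ V.to v ] _) (cong₂ _+_ ([≡ᵛ]-iso (src G f) v) ([≡ᵛ]-iso (tgt G f) v))

  deg-iso : ∀ v → deg H (V.to v) ≡ deg G v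
  deg-iso v = begin
    deg H (V.to v)                               ≡⟨ sumFin≡sum (λ f → endsAt H f (V.to v)) ⟩
    ℕSum.sum (λ f → endsAt H f (V.to v))         ≡⟨ ℕSum.sum-permute _ emap ⟩
    ℕSum.sum (λ f → endsAt H (E.to f) (V.to v))  ≡⟨ sym (sumFin≡sum (λ f → endsAt H (E.to f) (V.to v))) ⟩
    sumFin (λ f → endsAt H (E.to f) (V.to v))    ≡⟨ sumFin-cong (λ f → endsAt-iso f v) ⟩
    deg G v                                      ∎
    where open ≡-Reasoning

  iso-TwoOrOddDegrees : TwoOrOddDegrees G → TwoOrOddDegrees H
  iso-TwoOrOddDegrees G-degrees w =
    subst (λ d → d ≡ 2 ⊎ Odd d) (sym deg-w) (G-degrees (V.from w))
    where
    deg-w : deg H w ≡ deg G (V.from w)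
    deg-w = trans (cong (deg H) (sym (V.inverseˡ refl))) (deg-iso (V.from w))

InS⇒TwoOrOddDegrees : ∀ G → InS G → TwoOrOddDegrees G
InS⇒TwoOrOddDegrees G (H , H-odd , G′ , sub , iso) = iso-TwoOrOddDegrees iso (subdivision-degrees H-odd sub)

bit : Fin 2 → Bool
bit zero       = false
bit (suc zero) = true

bit-xor : ∀ c d → bit c xor bit d ≡ not ⌊ c ≟ d ⌋
bit-xor zero       zero       = refl
bit-xor zero       (suc zero) = refl
bit-xor (suc zero) zero       = refl
bit-xor (suc zero) (suc zero) = refl

Fin2-≢⇒cover : ∀ {c d : Fin 2} → c ≢ d → ∀ x → x ≡ c ⊎ x ≡ d
Fin2-≢⇒cover {zero}     {zero}     c≢d _          = ⊥-elim (c≢d refl)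
Fin2-≢⇒cover {suc zero} {suc zero} c≢d _          = ⊥-elim (c≢d refl)
Fin2-≢⇒cover {zero}     {suc zero} _   zero       = inj₁ refl
Fin2-≢⇒cover {zero}     {suc zero} _   (suc zero) = inj₂ refl
Fin2-≢⇒cover {suc zero} {zero}     _   zero       = inj₂ refl
Fin2-≢⇒cover {suc zero} {zero}     _   (suc zero) = inj₁ refl

-- e and f are consecutive edges at x on a closed walk: two different edges at x, or one loop at x.
MeetAt : (G : Graph) → Fin (nE G) → Fin (nE G) → Fin (nV G) → Set
MeetAt G e f x = (e ≢ f × Incident G e x × Incident G f x) ⊎ (e ≡ f × 2 ≤ endsAt G e x)

meetAt⇒incident : ∀ {G e f x} → MeetAt G e f x → Incident G e x × Incident G f x
meetAt⇒incident (inj₁ (_ , e-at-x , f-at-x)) = e-at-x , f-at-x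
meetAt⇒incident (inj₂ (refl , loop))          = ≤-trans (s≤s z≤n) loop , ≤-trans (s≤s z≤n) loop

cycle-meetAt : ∀ G (C : Cycle G) i → MeetAt G (Cycle.es C i) (Cycle.es C (next i)) (Cycle.vs C (next i))
cycle-meetAt G record { k = zero ; joins = joins } zero = inj₂ (refl , joins-loop {G = G} (joins zero))
cycle-meetAt G record { k = suc k ; es-inj = es-inj ; joins = joins } i =
  inj₁ ( (λ eᵢ≡eₙ → next-≢ i (sym (es-inj eᵢ≡eₙ)))
       , joins⇒incidentʳ {G = G} (joins i) , joins⇒incidentˡ {G = G} (joins (next i)))

colEnds : (G : Graph) {m : ℕ} → (Fin (nE G) → Fin m) → Fin m → Fin (nV G) → Fin (nE G) → ℕ
colEnds G col c x e = if ⌊ col e ≟ c ⌋ then endsAt G e x else 0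

module _ (G : Graph) {m} (col : Fin (nE G) → Fin m) where
  colEnds-own : ∀ {c e} x → col e ≡ c → colEnds G col c x e ≡ endsAt G e x
  colEnds-own {c} {e} x col-e≡c with col e ≟ c
  ... | yes _       = refl
  ... | no  col-e≢c = ⊥-elim (col-e≢c col-e≡c)

  endsAt≤colDeg : ∀ e x → endsAt G e x ≤ colDeg G col (col e) x
  endsAt≤colDeg e x = subst (_≤ colDeg G col (col e) x) (colEnds-own x refl) (term≤sumFin (colEnds G col (col e) x) e)

  colDeg≤deg : ∀ c x → colDeg G col c x ≤ deg G x
  colDeg≤deg c x = sumFin-mono colEnds≤endsAt
    where
    colEnds≤endsAt : ∀ e → colEnds G col c x e ≤ endsAt G e x
    colEnds≤endsAt e with col e ≟ c
    ... | yes _ = ≤-refl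
    ... | no  _ = z≤n

  meetAt⇒2≤colDeg : ∀ {e f x} → MeetAt G e f x → col e ≡ col f → 2 ≤ colDeg G col (col e) x
  meetAt⇒2≤colDeg {e} {f} {x} (inj₁ (e≢f , e-at-x , f-at-x)) col-e≡col-f =
    ≤-trans (+-mono-≤ e-at-x f-at-x)
      (subst₂ (λ a b → a + b ≤ colDeg G col (col e) x) (colEnds-own x refl) (colEnds-own x (sym col-e≡col-f))
        (two-terms≤sumFin (colEnds G col (col e) x) e≢f))
  meetAt⇒2≤colDeg {e} {x = x} (inj₂ (refl , loop)) _ = ≤-trans loop (endsAt≤colDeg e x)

  colDeg-monochromatic : ∀ {x c₀} → (∀ e → Incident G e x → col e ≡ c₀) →
                         ∀ c → colDeg G col c x ≡ (if ⌊ c₀ ≟ c ⌋ then deg G x else 0)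
  colDeg-monochromatic {x} {c₀} mono c =
    trans (sumFin-cong (λ e → colEnds-mono e (endsAt G e x) refl)) (sumFin-if ⌊ c₀ ≟ c ⌋)
    where
    colEnds-mono : ∀ e n → endsAt G e x ≡ n →
                   (if ⌊ col e ≟ c ⌋ then endsAt G e x else 0) ≡ (if ⌊ c₀ ≟ c ⌋ then endsAt G e x else 0)
    colEnds-mono e zero ends≡0 rewrite ends≡0 with col e ≟ c | c₀ ≟ c
    ... | yes _ | yes _ = refl
    ... | yes _ | no  _ = refl
    ... | no  _ | yes _ = refl
    ... | no  _ | no  _ = refl
    colEnds-mono e (suc n) ends≡1+n rewrite mono e (subst (1 ≤_) (sym ends≡1+n) (s≤s z≤n)) = refl
    sumFin-if : ∀ b → sumFin (λ e → if b then endsAt G e x else 0) ≡ (if b then deg G x else 0)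
    sumFin-if true  = refl
    sumFin-if false = sumFin-zero {f = λ e → if false then endsAt G e x else 0} (λ _ → refl)

colDeg-0+1 : ∀ (G : Graph) (col : Fin (nE G) → Fin 2) x →
             colDeg G col zero x + colDeg G col (suc zero) x ≡ deg G x
colDeg-0+1 G col x = trans (sym (sumFin-+ (colEnds G col zero x) (colEnds G col (suc zero) x))) (sumFin-cong split)
  where
  split : ∀ e → colEnds G col zero x e + colEnds G col (suc zero) x e ≡ endsAt G e x
  split e with col e
  ... | zero     = +-identityʳ _
  ... | suc zero = refl

colDeg-complementary : ∀ (G : Graph) (col : Fin (nE G) → Fin 2) {c d} → c ≢ d →
                       ∀ x → colDeg G col c x + colDeg G col d x ≡ deg G x
colDeg-complementary G col {zero}     {zero}     0≢0 x = ⊥-elim (0≢0 refl)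
colDeg-complementary G col {suc zero} {suc zero} 1≢1 x = ⊥-elim (1≢1 refl)
colDeg-complementary G col {zero}     {suc zero} _   x = colDeg-0+1 G col x
colDeg-complementary G col {suc zero} {zero}     _   x =
  trans (+-comm (colDeg G col (suc zero) x) _) (colDeg-0+1 G col x)

both-positive-sum-2 : ∀ {m n} → m + n ≡ 2 → 1 ≤ m → 1 ≤ n → m ≡ 1 × n ≡ 1
both-positive-sum-2 {suc zero}    {suc zero}     _  _ _ = refl , refl
both-positive-sum-2 {suc zero}    {suc (suc _)}  () _ _
both-positive-sum-2 {suc (suc m)} {suc n}        eq _ _ = ⊥-elim (m+1+n≢0 m (suc-injective (suc-injective eq)))

colDeg-deg2 : ∀ G (col : Fin (nE G) → Fin 2) {e f x} → deg G x ≡ 2 →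
              Incident G e x → Incident G f x → col e ≢ col f → ∀ c → colDeg G col c x ≡ 1
colDeg-deg2 G col {e} {f} {x} deg≡2 e-at-x f-at-x differ c
  with Fin2-≢⇒cover differ c
     | both-positive-sum-2 (trans (colDeg-complementary G col differ x) deg≡2)
         (≤-trans e-at-x (endsAt≤colDeg G col e x)) (≤-trans f-at-x (endsAt≤colDeg G col f x))
... | inj₁ refl | once , _ = once
... | inj₂ refl | _ , once = once

-- Switching at the degree-2 vertices of a cycle

isDeg2 : (G : Graph) → Fin (nV G) → Bool
isDeg2 G x = ⌊ deg G x ℕ.≟ 2 ⌋

isDeg2-≡2 : ∀ {G x} → deg G x ≡ 2 → isDeg2 G x ≡ true
isDeg2-≡2 {G} {x} deg≡2 with deg G x ℕ.≟ 2
... | yes _     = refl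
... | no  deg≢2 = ⊥-elim (deg≢2 deg≡2)

isDeg2-odd : ∀ {G x} → Odd (deg G x) → isDeg2 G x ≡ false
isDeg2-odd {G} {x} odd with deg G x ℕ.≟ 2
... | yes deg≡2 = ⊥-elim (¬Odd-2 (subst Odd deg≡2 odd))
... | no  _     = refl

-- F e x labels the end x of the edge e; F switches at x exactly when d(x) = 2.
Switching : (G : Graph) → (Fin (nE G) → Fin (nV G) → Bool) → Set
Switching G F = ∀ {e f x} → MeetAt G e f x → F e x xor F f x ≡ isDeg2 G x

parity-deg2Count : ∀ G (C : Cycle G) F → Switching G F →
  let open Cycle C in
  parity (deg2Count G C) ≡ xorSum (λ i → F (es i) (vs i) xor F (es i) (vs (next i)))
parity-deg2Count G C F switching = begin
  parity (deg2Count G C)           ≡⟨ parity-sumFin-indicator (λ i → isDeg2 G (vs i)) ⟩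
  xorSum (λ i → isDeg2 G (vs i))   ≡⟨ sym (xorSum-around (λ i → F (es i) (vs i)) (λ i → F (es i) (vs (next i))) (λ i → isDeg2 G (vs i))
                                                     (λ i → switching (cycle-meetAt G C i))) ⟩
  xorSum (λ i → F (es i) (vs i) xor F (es i) (vs (next i))) ∎
  where
  open ≡-Reasoning
  open Cycle C

module _ (G : Graph) (degrees : TwoOrOddDegrees G)
         (col : Fin (nE G) → Fin 2) (odd-col : IsOddColouring G col) where

  positive-colDeg-odd : ∀ c x → 1 ≤ colDeg G col c x → parity (colDeg G col c x) ≡ true
  positive-colDeg-odd c x 1≤colDeg with odd-col c x
  ... | inj₂ odd    = odd⇒parity≡true odd
  ... | inj₁ colDeg≡0 with subst (1 ≤_) colDeg≡0 1≤colDeg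
  ...   | ()

  oddColouring-switching : Switching G (λ e _ → bit (col e))
  oddColouring-switching {e} {f} {x} meet
    rewrite bit-xor (col e) (col f) with col e ≟ col f | degrees x
  ... | yes same | inj₁ deg≡2 = ⊥-elim (colour-clash (odd-col (col e) x))
    where
    colDeg≡2 : colDeg G col (col e) x ≡ 2
    colDeg≡2 = ≤-antisym (subst (colDeg G col (col e) x ≤_) deg≡2 (colDeg≤deg G col (col e) x))
                         (meetAt⇒2≤colDeg G col meet same)
    colour-clash : colDeg G col (col e) x ≡ 0 ⊎ Odd (colDeg G col (col e) x) → ⊥
    colour-clash (inj₁ colDeg≡0) with trans (sym colDeg≡2) colDeg≡0
    ... | ()
    colour-clash (inj₂ odd) = ¬Odd-2 (subst Odd colDeg≡2 odd)
  ... | yes _    | inj₂ odd   = sym (isDeg2-odd {G} odd)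
  ... | no  _    | inj₁ deg≡2 = sym (isDeg2-≡2 {G} deg≡2)
  ... | no  diff | inj₂ odd   with trans (sym (odd⇒parity≡true odd)) parity-deg
    where
    incidences = meetAt⇒incident {G} meet
    parity-deg : parity (deg G x) ≡ false
    parity-deg = begin
      parity (deg G x)                                               ≡⟨ cong parity (sym (colDeg-complementary G col diff x)) ⟩
      parity (colDeg G col (col e) x + colDeg G col (col f) x)       ≡⟨ parity-+ (colDeg G col (col e) x) _ ⟩
      parity (colDeg G col (col e) x) xor parity (colDeg G col (col f) x)
        ≡⟨ cong₂ _xor_ (positive-colDeg-odd (col e) x (≤-trans (proj₁ incidences) (endsAt≤colDeg G col e x)))
                       (positive-colDeg-odd (col f) x (≤-trans (proj₂ incidences) (endsAt≤colDeg G col f x))) ⟩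
      false                                                          ∎
      where open ≡-Reasoning
  ...   | ()

  oddColouring⇒even-deg2Count : (C : Cycle G) → Even (deg2Count G C)
  oddColouring⇒even-deg2Count C = parity≡false⇒even (deg2Count G C) (begin
    parity (deg2Count G C)                              ≡⟨ parity-deg2Count G C (λ e _ → bit (col e)) oddColouring-switching ⟩
    xorSum (λ i → bit (col (es i)) xor bit (col (es i))) ≡⟨ xorSum-cong (λ i → xor-same (bit (col (es i)))) ⟩
    xorSum {suc k} (λ _ → false)                         ≡⟨ XorSum.sum-replicate-zero (suc k) ⟩
    false                                                ∎)
    where
    open ≡-Reasoning
    open Cycle C

-- Simple paths and reachability

record SimplePath (G : Graph) (u w : Fin (nV G)) : Set where
  field
    len    : ℕ
    vs     : Fin (suc len) → Fin (nV G)
    es     : Fin len → Fin (nE G)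
    start  : vs zero ≡ u
    end    : vs (fromℕ len) ≡ w
    vs-inj : Injective _≡_ _≡_ vs
    es-inj : Injective _≡_ _≡_ es
    joins  : ∀ i → Joins G (es i) (vs (inject₁ i)) (vs (suc i))

module _ {G : Graph} where

  trivialPath : ∀ q → SimplePath G q q
  trivialPath q = record
    { len = 0 ; vs = λ _ → q ; es = λ () ; start = refl ; end = refl
    ; vs-inj = λ { {zero} {zero} _ → refl } ; es-inj = λ { {()} } ; joins = λ () }

  consPath : ∀ {f u v w} → Joins G f v u → (P : SimplePath G u w) →
             (∀ i → SimplePath.vs P i ≢ v) → SimplePath G v w
  consPath {f} {u} {v} f-joins P v∉P = record
    { len = suc len ; vs = vs′ ; es = es′ ; start = refl ; end = end
    ; vs-inj = vs′-inj ; es-inj = es′-inj ; joins = joins′ }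
    where
    open SimplePath P
    vs′ : Fin (suc (suc len)) → Fin (nV G)
    vs′ zero    = v
    vs′ (suc i) = vs i
    es′ : Fin (suc len) → Fin (nE G)
    es′ zero    = f
    es′ (suc i) = es i
    vs′-inj : Injective _≡_ _≡_ vs′
    vs′-inj {zero}  {zero}  _  = refl
    vs′-inj {zero}  {suc y} eq = ⊥-elim (v∉P y (sym eq))
    vs′-inj {suc x} {zero}  eq = ⊥-elim (v∉P x eq)
    vs′-inj {suc x} {suc y} eq = cong suc (vs-inj eq)
    f∉P : ∀ i → f ≢ es i
    f∉P i f≡esᵢ with joins-endpoints {G = G} f-joins (subst (λ g → Joins G g _ _) (sym f≡esᵢ) (joins i))
    ... | inj₁ v≡ = v∉P (inject₁ i) (sym v≡)
    ... | inj₂ v≡ = v∉P (suc i) (sym v≡)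
    es′-inj : Injective _≡_ _≡_ es′
    es′-inj {zero}  {zero}  _  = refl
    es′-inj {zero}  {suc y} eq = ⊥-elim (f∉P y eq)
    es′-inj {suc x} {zero}  eq = ⊥-elim (f∉P x (sym eq))
    es′-inj {suc x} {suc y} eq = cong suc (es-inj eq)
    joins′ : ∀ i → Joins G (es′ i) (vs′ (inject₁ i)) (vs′ (suc i))
    joins′ zero    = subst (Joins G f v) (sym start) f-joins
    joins′ (suc i) = joins i

Closed : (G : Graph) → (Fin (nV G) → Bool) → Set
Closed G R = ∀ e → R (src G e) ≡ R (tgt G e)

Cut : (G : Graph) → Fin (nV G) → Fin (nV G) → Set
Cut G p q = Σ (Fin (nV G) → Bool) λ R → Closed G R × R q ≡ true × R p ≡ false

module Reachability (G : Graph) (q : Fin (nV G)) where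
  private
    V = Fin (nV G)

  record ReachableSet : Set where
    field
      R     : V → Bool
      R-q   : R q ≡ true
      paths : ∀ v → R v ≡ true → Σ (SimplePath G v q) λ P → ∀ i → R (SimplePath.vs P i) ≡ true
  open ReachableSet

  outside : (V → Bool) → ℕ
  outside R = sumFin (λ x → if R x then 0 else 1)

  insert : (V → Bool) → V → V → Bool
  insert R v x = R x ∨ ⌊ x ≟ v ⌋

  insert-⊇ : ∀ R v {x} → R x ≡ true → insert R v x ≡ true
  insert-⊇ R v {x} Rx rewrite Rx = refl

  insert-∋ : ∀ R v → insert R v v ≡ true
  insert-∋ R v with v ≟ v
  ... | yes _   = ∨-zeroʳ (R v)
  ... | no  v≢v = ⊥-elim (v≢v refl)

  outside-insert : ∀ R v → R v ≡ false → outside R ≡ suc (outside (insert R v))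
  outside-insert R v Rv≡false =
    trans (sumFin-pick v _) (cong₂ _+_ (cong (λ b → if b then 0 else 1) Rv≡false) (sumFin-cong off-v))
    where
    off-v : ∀ x → zeroAt v (λ x → if R x then 0 else 1) x ≡ (if insert R v x then 0 else 1)
    off-v x with x ≟ v | R x
    ... | yes _ | true  = refl
    ... | yes _ | false = refl
    ... | no  _ | true  = refl
    ... | no  _ | false = refl

  initial : ReachableSet
  initial = record { R = λ x → ⌊ x ≟ q ⌋ ; R-q = q∈R ; paths = paths₀ }
    where
    q∈R : ⌊ q ≟ q ⌋ ≡ true
    q∈R with q ≟ q
    ... | yes _   = refl
    ... | no  q≢q = ⊥-elim (q≢q refl)
    paths₀ : ∀ v → ⌊ v ≟ q ⌋ ≡ true → Σ (SimplePath G v q) λ P → ∀ i → ⌊ SimplePath.vs P i ≟ q ⌋ ≡ true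
    paths₀ v v∈R with v ≟ q
    ... | yes refl = trivialPath q , λ _ → q∈R
    ... | no  _ with v∈R
    ...   | ()

  extend : (S : ReachableSet) → ∀ {f u v} → Joins G f v u → R S u ≡ true → R S v ≡ false → ReachableSet
  extend S {f} {u} {v} f-joins u∈S v∉S = record
    { R = insert (R S) v ; R-q = insert-⊇ (R S) v (R-q S) ; paths = paths′ }
    where
    paths′ : ∀ x → insert (R S) v x ≡ true →
             Σ (SimplePath G x q) λ P → ∀ i → insert (R S) v (SimplePath.vs P i) ≡ true
    paths′ x x∈S′ with R S x in x∈S | x ≟ v
    ... | true  | _        = let P , P⊆S = paths S x x∈S in P , λ i → insert-⊇ (R S) v (P⊆S i)
    ... | false | yes refl =
      let P , P⊆S = paths S u u∈S in
      consPath f-joins P (λ i vsᵢ≡v → true≢false (trans (sym (P⊆S i)) (trans (cong (R S) vsᵢ≡v) v∉S))) ,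
      λ { zero → insert-∋ (R S) v ; (suc i) → insert-⊇ (R S) v (P⊆S i) }
    ... | false | no  _ with x∈S′
    ...   | ()

  Crossing : ReachableSet → Set
  Crossing S = ∃ λ f → ∃ λ u → ∃ λ v → Joins G f v u × R S u ≡ true × R S v ≡ false

  crossing-or-closed : (S : ReachableSet) → Crossing S ⊎ Closed G (R S)
  crossing-or-closed S with Finₚ.any? (λ f → ¬? (R S (src G f) ≟ᵇ R S (tgt G f)))
  ... | no  none       = inj₂ (λ f → decidable-stable (R S (src G f) ≟ᵇ R S (tgt G f)) (λ ≢ → none (f , ≢)))
  ... | yes (f , R≢R) with R S (src G f) in src∈ | R S (tgt G f) in tgt∈
  ...   | true  | true  = ⊥-elim (R≢R refl)
  ...   | false | false = ⊥-elim (R≢R refl)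
  ...   | true  | false = inj₁ (f , src G f , tgt G f , inj₂ refl , src∈ , tgt∈)
  ...   | false | true  = inj₁ (f , tgt G f , src G f , inj₁ refl , tgt∈ , src∈)

  grow : ∀ n (S : ReachableSet) → outside (R S) ≡ n → Σ ReachableSet (λ S → Closed G (R S))
  grow n S outside≡n with crossing-or-closed S
  ... | inj₂ closed = S , closed
  ... | inj₁ (f , u , v , f-joins , u∈S , v∉S) with n
  ...   | zero with trans (sym outside≡n) (outside-insert (R S) v v∉S)
  ...     | ()
  grow n S outside≡n | inj₁ (f , u , v , f-joins , u∈S , v∉S) | suc n′ =
    grow n′ (extend S f-joins u∈S v∉S) (suc-injective (trans (sym (outside-insert (R S) v v∉S)) outside≡n))

path-or-cut : ∀ G p q → SimplePath G p q ⊎ Cut G p q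
path-or-cut G p q = decide (grow _ initial refl)
  where
  open Reachability G q
  decide : Σ ReachableSet (λ S → Closed G (ReachableSet.R S)) → SimplePath G p q ⊎ Cut G p q
  decide (S , closed) with ReachableSet.R S p in p∈S
  ... | true  = inj₁ (proj₁ (ReachableSet.paths S p p∈S))
  ... | false = inj₂ (ReachableSet.R S , closed , ReachableSet.R-q S , p∈S)

-- Potentials of edge labellings

Potential : (G : Graph) → (Fin (nE G) → Bool) → (Fin (nV G) → Bool) → Set
Potential G σ a = ∀ e → a (src G e) xor a (tgt G e) ≡ σ e

OddCycle : (G : Graph) → (Fin (nE G) → Bool) → Set
OddCycle G σ = Σ (Cycle G) λ C → xorSum (λ i → σ (Cycle.es C i)) ≡ true

xor-interchange : ∀ w x y z → (w xor x) xor (y xor z) ≡ (w xor y) xor (x xor z)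
xor-interchange = CommutativeSemigroupProperties.interchange
  where
  module CommutativeSemigroupProperties = Algebra.Properties.CommutativeSemigroup
    (CommutativeMonoid.commutativeSemigroup (CommutativeRing.+-commutativeMonoid xor-∧-commutativeRing))

xor-≢ : ∀ {x y} → x ≢ y → x xor y ≡ true
xor-≢ {x} {y} x≢y = trans (cong (_xor y) (¬-not x≢y)) (xor-inverseˡ y)

module _ {G : Graph} {σ : Fin (nE G) → Bool} {a : Fin (nV G) → Bool} (potential : Potential G σ a) where

  potential-joins : ∀ {e u w} → Joins G e u w → a u xor a w ≡ σ e
  potential-joins {e} e-joins = trans (sym (xor-ends-joins {G} a e-joins)) (potential e)

  potential-walk : ∀ len (vs : Fin (suc len) → Fin (nV G)) (es : Fin len → Fin (nE G)) →
                   (∀ i → Joins G (es i) (vs (inject₁ i)) (vs (suc i))) →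
                   xorSum (λ i → σ (es i)) ≡ a (vs zero) xor a (vs (fromℕ len))
  potential-walk zero    vs es joins = sym (xor-same (a (vs zero)))
  potential-walk (suc len) vs es joins = begin
    σ (es zero) xor xorSum (λ i → σ (es (suc i)))                       ≡⟨ cong₂ _xor_ (sym (potential-joins (joins zero)))
                                                                             (potential-walk len (tail vs) (tail es) (λ i → joins (suc i))) ⟩
    (a (vs zero) xor a (vs (suc zero))) xor (a (vs (suc zero)) xor a v) ≡⟨ xor-assoc (a (vs zero)) _ _ ⟩
    a (vs zero) xor (a (vs (suc zero)) xor (a (vs (suc zero)) xor a v)) ≡⟨ cong (a (vs zero) xor_) (sym (xor-assoc (a (vs (suc zero))) _ _)) ⟩
    a (vs zero) xor ((a (vs (suc zero)) xor a (vs (suc zero))) xor a v) ≡⟨ cong (λ b → a (vs zero) xor (b xor a v)) (xor-same (a (vs (suc zero)))) ⟩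
    a (vs zero) xor a v                                                 ∎
    where
    open ≡-Reasoning
    v = vs (fromℕ (suc len))

potential-flip : ∀ {G σ a} → Potential G σ a → ∀ {R} → Closed G R → Potential G σ (λ x → a x xor R x)
potential-flip {G} {σ} {a} potential {R} closed e = begin
  (a (src G e) xor R (src G e)) xor (a (tgt G e) xor R (tgt G e)) ≡⟨ xor-interchange (a (src G e)) _ _ _ ⟩
  (a (src G e) xor a (tgt G e)) xor (R (src G e) xor R (tgt G e)) ≡⟨ cong₂ _xor_ (potential e) (trans (cong (R (src G e) xor_) (sym (closed e))) (xor-same (R (src G e)))) ⟩
  σ e xor false                                                   ≡⟨ xor-identityʳ (σ e) ⟩
  σ e                                                             ∎
  where open ≡-Reasoning

_∷ʳ_ : ∀ {A : Set} {n} → (Fin n → A) → A → Fin (suc n) → A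
_∷ʳ_ {n = zero}  f x zero    = x
_∷ʳ_ {n = suc n} f x zero    = f zero
_∷ʳ_ {n = suc n} f x (suc i) = (tail f ∷ʳ x) i

∷ʳ-inject₁ : ∀ {A : Set} {n} (f : Fin n → A) x j → (f ∷ʳ x) (inject₁ j) ≡ f j
∷ʳ-inject₁ f x zero    = refl
∷ʳ-inject₁ f x (suc j) = ∷ʳ-inject₁ (tail f) x j

∷ʳ-fromℕ : ∀ {A : Set} {n} (f : Fin n → A) x → (f ∷ʳ x) (fromℕ n) ≡ x
∷ʳ-fromℕ {n = zero}  f x = refl
∷ʳ-fromℕ {n = suc n} f x = ∷ʳ-fromℕ (tail f) x

∷ʳ-injective : ∀ {A : Set} {n} {f : Fin n → A} {x} → Injective _≡_ _≡_ f → (∀ j → f j ≢ x) →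
               Injective _≡_ _≡_ (f ∷ʳ x)
∷ʳ-injective {f = f} {x} f-inj x∉f {i} {i′} eq with initOrLast i | initOrLast i′
... | init j | init j′ = cong inject₁ (f-inj (trans (sym (∷ʳ-inject₁ f x j)) (trans eq (∷ʳ-inject₁ f x j′))))
... | init j | last    = ⊥-elim (x∉f j (trans (sym (∷ʳ-inject₁ f x j)) (trans eq (∷ʳ-fromℕ f x))))
... | last   | init j′ = ⊥-elim (x∉f j′ (trans (sym (∷ʳ-inject₁ f x j′)) (trans (sym eq) (∷ʳ-fromℕ f x))))
... | last   | last    = refl

xorSum-∷ʳ : ∀ {A : Set} {n} (g : A → Bool) (f : Fin n → A) x →
            xorSum (λ i → g ((f ∷ʳ x) i)) ≡ xorSum (λ j → g (f j)) xor g x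
xorSum-∷ʳ g f x = trans (XorSum.sum-init-last (λ i → g ((f ∷ʳ x) i)))
                        (cong₂ _xor_ (xorSum-cong (λ j → cong g (∷ʳ-inject₁ f x j))) (cong g (∷ʳ-fromℕ f x)))

closePath : ∀ {G p q e} (P : SimplePath G p q) → Joins G e q p → (∀ i → SimplePath.es P i ≢ e) → Cycle G
closePath {G} {p} {q} {e} P e-joins e∉P = record
  { k = len ; vs = vs ; es = es ∷ʳ e ; vs-inj = vs-inj ; es-inj = ∷ʳ-injective es-inj e∉P ; joins = joins′ }
  where
  open SimplePath P
  joins′ : ∀ i → Joins G ((es ∷ʳ e) i) (vs i) (vs (next i))
  joins′ i with initOrLast i
  ... | init j rewrite ∷ʳ-inject₁ es e j | next-inject₁ j = joins j
  ... | last   rewrite ∷ʳ-fromℕ es e | next-fromℕ len = subst₂ (Joins G e) (sym end) (sym start) e-joins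

graph : ∀ n m → (Fin m → Fin n × Fin n) → Graph
graph n m en = record { nV = n ; nE = m ; ends = en }

-- Adding the edge e₀ = (p, q) to G⁻: either a potential of G⁻ fits e₀, or it can be flipped on
-- a closed set separating p from q, or a path from p to q in G⁻ closes with e₀ to an odd cycle.
module AddFirstEdge {n m} (en : Fin (suc m) → Fin n × Fin n) (σ : Fin (suc m) → Bool) where
  private
    G G⁻ : Graph
    G  = graph n (suc m) en
    G⁻ = graph n m (tail en)
    p q : Fin n
    p = proj₁ (en zero)
    q = proj₂ (en zero)

  liftPath : ∀ {u w} → SimplePath G⁻ u w → SimplePath G u w
  liftPath P = record
    { len = len ; vs = vs ; es = λ i → suc (es i) ; start = start ; end = end
    ; vs-inj = vs-inj ; es-inj = λ eq → es-inj (Finₚ.suc-injective eq) ; joins = joins }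
    where open SimplePath P

  liftCycle : Cycle G⁻ → Cycle G
  liftCycle C = record
    { k = k ; vs = vs ; es = λ i → suc (es i)
    ; vs-inj = vs-inj ; es-inj = λ eq → es-inj (Finₚ.suc-injective eq) ; joins = joins }
    where open Cycle C

  extend : ∀ a → Potential G⁻ (tail σ) a → ∃ (Potential G σ) ⊎ OddCycle G σ
  extend a potential with a p xor a q ≟ᵇ σ zero
  ... | yes fits  = inj₁ (a , λ { zero → fits ; (suc e) → potential e })
  ... | no misfit with path-or-cut G⁻ p q
  ...   | inj₂ (R , closed , q∈R , p∉R) = inj₁ ((λ x → a x xor R x) , flipped)
    where
    flipped : Potential G σ (λ x → a x xor R x)
    flipped zero    = begin
      (a p xor R p) xor (a q xor R q) ≡⟨ xor-interchange (a p) (R p) (a q) (R q) ⟩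
      (a p xor a q) xor (R p xor R q) ≡⟨ cong (λ r → (a p xor a q) xor r) (cong₂ _xor_ p∉R q∈R) ⟩
      (a p xor a q) xor true          ≡⟨ xor-comm (a p xor a q) true ⟩
      not (a p xor a q)               ≡⟨ sym (¬-not (λ σ≡ → misfit (sym σ≡))) ⟩
      σ zero                          ∎
      where open ≡-Reasoning
    flipped (suc e) = potential-flip {G⁻} {tail σ} {a} potential {R} closed e
  ...   | inj₁ P = inj₂ (closePath (liftPath P) (inj₂ refl) (λ _ ()) , odd)
    where
    open SimplePath P
    odd : xorSum (λ i → σ (((λ j → suc (es j)) ∷ʳ zero) i)) ≡ true
    odd = begin
      xorSum (λ i → σ (((λ j → suc (es j)) ∷ʳ zero) i)) ≡⟨ xorSum-∷ʳ σ (λ j → suc (es j)) zero ⟩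
      xorSum (λ j → σ (suc (es j))) xor σ zero           ≡⟨ cong (_xor σ zero) (potential-walk {G⁻} {tail σ} {a} potential len vs es joins) ⟩
      (a (vs zero) xor a (vs (fromℕ len))) xor σ zero    ≡⟨ cong (λ x → x xor σ zero) (cong₂ (λ u w → a u xor a w) start end) ⟩
      (a p xor a q) xor σ zero                           ≡⟨ xor-≢ misfit ⟩
      true                                               ∎
      where open ≡-Reasoning

potential-or-oddCycle : ∀ G σ → ∃ (Potential G σ) ⊎ OddCycle G σ
potential-or-oddCycle G = by-edges (nV G) (nE G) (ends G)
  where
  by-edges : ∀ n m en σ → ∃ (Potential (graph n m en) σ) ⊎ OddCycle (graph n m en) σ
  by-edges n zero    en σ = inj₁ ((λ _ → false) , λ ())
  by-edges n (suc m) en σ with by-edges n m (tail en) (tail σ)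
  ... | inj₁ (a , potential) = AddFirstEdge.extend en σ a potential
  ... | inj₂ (C , odd)       = inj₂ (AddFirstEdge.liftCycle en σ C , odd)

-- Constructing an odd 2-edge-colouring

2≤endsAt⇒loop : ∀ {G e x} → 2 ≤ endsAt G e x → Joins G e x x
2≤endsAt⇒loop {G} {e} {x} 2≤ends with src G e ≟ x | tgt G e ≟ x | 2≤ends
... | yes src≡x | yes tgt≡x | _      = inj₁ (cong₂ _,_ src≡x tgt≡x)
... | yes _     | no  _     | s≤s ()
... | no  _     | yes _     | s≤s ()
... | no  _     | no  _     | ()

loopCycle : ∀ {G e x} → Joins G e x x → Cycle G
loopCycle {e = e} {x} loop = record
  { k = 0 ; vs = λ _ → x ; es = λ _ → e
  ; vs-inj = λ { {zero} {zero} _ → refl } ; es-inj = λ { {zero} {zero} _ → refl } ; joins = λ { zero → loop } }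

two-incident-edges : ∀ G x → deg G x ≡ 2 → (∀ e → ¬ 2 ≤ endsAt G e x) →
                     ∃ λ e → ∃ λ f → e ≢ f × Incident G e x × Incident G f x
two-incident-edges G x deg≡2 no-loop with sumFin-nonzero (λ e → endsAt G e x) (λ deg≡0 → 1+n≢0 (trans (sym deg≡2) deg≡0))
... | e , ends-e≢0 with sumFin-nonzero (zeroAt e (λ g → endsAt G g x)) rest≢0
  where
  ends-e≡1 : endsAt G e x ≡ 1
  ends-e≡1 with endsAt G e x in ends≡
  ... | zero        = ⊥-elim (ends-e≢0 refl)
  ... | suc zero    = refl
  ... | suc (suc _) = ⊥-elim (no-loop e (subst (2 ≤_) (sym ends≡) (s≤s (s≤s z≤n))))
  rest≢0 : sumFin (zeroAt e (λ g → endsAt G g x)) ≢ 0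
  rest≢0 rest≡0 with trans (sym deg≡2) (trans (sumFin-pick e (λ g → endsAt G g x)) (cong₂ _+_ ends-e≡1 rest≡0))
  ... | ()
... | f , rest-f≢0 = e , f , e≢f , n≢0⇒n>0 ends-e≢0 , n≢0⇒n>0 ends-f≢0
  where
  e≢f : e ≢ f
  e≢f refl = rest-f≢0 (zeroAt-self e (λ g → endsAt G g x))
  ends-f≢0 : endsAt G f x ≢ 0
  ends-f≢0 = subst (_≢ 0) (zeroAt-≢ (λ g → endsAt G g x) λ f≡e → e≢f (sym f≡e)) rest-f≢0

fromBit : Bool → Fin 2
fromBit false = zero
fromBit true  = suc zero

fromBit-≢ : ∀ {b c} → b xor c ≡ true → fromBit b ≢ fromBit c
fromBit-≢ {true}  {false} _ ()
fromBit-≢ {false} {true}  _ ()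

xor≡false⇒≡ : ∀ {b c} → b xor c ≡ false → b ≡ c
xor≡false⇒≡ {true}  {true}  _ = refl
xor≡false⇒≡ {false} {false} _ = refl

xor-swap : ∀ w x y z → w xor x ≡ y xor z → w xor y ≡ x xor z
xor-swap w x y z eq = xor≡false⇒≡ (begin
  (w xor y) xor (x xor z) ≡⟨ xor-interchange w y x z ⟩
  (w xor x) xor (y xor z) ≡⟨ cong (_xor (y xor z)) eq ⟩
  (y xor z) xor (y xor z) ≡⟨ xor-same (y xor z) ⟩
  false                   ∎)
  where open ≡-Reasoning

module EvenCycles (G : Graph) (degrees : TwoOrOddDegrees G)
                  (even : (C : Cycle G) → Even (deg2Count G C)) where

  -- A loop at a vertex of degree 2 would be a cycle through a single degree-2 vertex.
  no-loop-at-deg2 : ∀ {x} → deg G x ≡ 2 → ∀ e → ¬ 2 ≤ endsAt G e x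
  no-loop-at-deg2 {x} deg≡2 e 2≤ends = true≢false (sym (begin
    false                                           ≡⟨ sym (even⇒parity≡false (even (loopCycle (2≤endsAt⇒loop {G} 2≤ends)))) ⟩
    parity ((if isDeg2 G x then 1 else 0) + 0)      ≡⟨ cong (λ b → parity ((if b then 1 else 0) + 0)) (isDeg2-≡2 {G} deg≡2) ⟩
    true                                            ∎))
    where open ≡-Reasoning

  designated : ∀ x → Dec (∃ λ g → Incident G g x)
  designated x = Finₚ.any? (λ g → 1 ≤? endsAt G g x)

  isDesignated : Fin (nV G) → Fin (nE G) → Bool
  isDesignated x e with designated x
  ... | yes (g , _) = ⌊ g ≟ e ⌋
  ... | no  _       = false

  designated-one : ∀ {e f x} → deg G x ≡ 2 → e ≢ f → Incident G e x → Incident G f x →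
                   isDesignated x e xor isDesignated x f ≡ true
  designated-one {e} {f} {x} deg≡2 e≢f e-at-x f-at-x with designated x
  ... | no  none = ⊥-elim (none (e , e-at-x))
  ... | yes (g , g-at-x) with g ≟ e | g ≟ f
  ...   | yes refl | yes refl = ⊥-elim (e≢f refl)
  ...   | yes _    | no  _    = refl
  ...   | no  _    | yes _    = refl
  ...   | no  g≢e  | no  g≢f  with ≤-trans (+-mono-≤ g-at-x (+-mono-≤ e-at-x f-at-x))
                                   (subst (endsAt G g x + (endsAt G e x + endsAt G f x) ≤_) deg≡2
                                          (three-terms≤sumFin (λ h → endsAt G h x) g≢e g≢f e≢f))
  ...     | s≤s (s≤s ())

  -- Each vertex of degree 2 designates one of its two edges, which is twisted at that end.
  twist : Fin (nE G) → Fin (nV G) → Bool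
  twist e x = isDeg2 G x ∧ isDesignated x e

  twist-switching : Switching G twist
  twist-switching {e} {f} {x} meet with deg G x ℕ.≟ 2
  ... | no  _     = refl
  ... | yes deg≡2 with meet
  ...   | inj₁ (e≢f , e-at-x , f-at-x) = designated-one deg≡2 e≢f e-at-x f-at-x
  ...   | inj₂ (_ , loop)              = ⊥-elim (no-loop-at-deg2 deg≡2 e loop)

  σ : Fin (nE G) → Bool
  σ e = twist e (src G e) xor twist e (tgt G e)

  σ-joins : ∀ {e u w} → Joins G e u w → σ e ≡ twist e u xor twist e w
  σ-joins {e} = xor-ends-joins {G} (twist e)

  σ-cycle-even : (C : Cycle G) → xorSum (λ i → σ (Cycle.es C i)) ≡ false
  σ-cycle-even C = begin
    xorSum (λ i → σ (es i))                                           ≡⟨ xorSum-cong (λ i → σ-joins (joins i)) ⟩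
    xorSum (λ i → twist (es i) (vs i) xor twist (es i) (vs (next i))) ≡⟨ sym (parity-deg2Count G C twist twist-switching) ⟩
    parity (deg2Count G C)                                            ≡⟨ even⇒parity≡false (even C) ⟩
    false                                                             ∎
    where
    open ≡-Reasoning
    open Cycle C

  potential : ∃ (Potential G σ)
  potential = [ id , no-odd-cycle ]′ (potential-or-oddCycle G σ)
    where
    no-odd-cycle : OddCycle G σ → ∃ (Potential G σ)
    no-odd-cycle (C , odd) = ⊥-elim (true≢false (trans (sym odd) (σ-cycle-even C)))

  a : Fin (nV G) → Bool
  a = proj₁ potential

  colour : Fin (nE G) → Fin 2
  colour e = fromBit (a (src G e) xor twist e (src G e))

  colour-at : ∀ {e x} → Incident G e x → colour e ≡ fromBit (a x xor twist e x)
  colour-at {e} {x} e-at-x with incident⇒endpoint {G} e-at-x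
  ... | inj₁ refl = refl
  ... | inj₂ refl = cong fromBit (xor-swap (a (src G e)) (a (tgt G e)) (twist e (src G e)) (twist e (tgt G e)) (proj₂ potential e))

  colour-odd-vertex : ∀ {w} → Odd (deg G w) → ∀ e → Incident G e w → colour e ≡ fromBit (a w)
  colour-odd-vertex {w} odd e e-at-w = begin
    colour e                     ≡⟨ colour-at e-at-w ⟩
    fromBit (a w xor twist e w)  ≡⟨ cong (λ b → fromBit (a w xor (b ∧ isDesignated w e))) (isDeg2-odd {G} odd) ⟩
    fromBit (a w xor false)      ≡⟨ cong fromBit (xor-identityʳ (a w)) ⟩
    fromBit (a w)                ∎
    where open ≡-Reasoning

  colour-odd : IsOddColouring G colour
  colour-odd c w with degrees w
  ... | inj₂ odd rewrite colDeg-monochromatic G colour (colour-odd-vertex odd) c with fromBit (a w) ≟ c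
  ...   | yes _ = inj₂ odd
  ...   | no  _ = inj₁ refl
  colour-odd c w | inj₁ deg≡2 with two-incident-edges G w deg≡2 (no-loop-at-deg2 deg≡2)
  ... | e , f , e≢f , e-at-w , f-at-w =
    inj₂ (subst Odd (sym (colDeg-deg2 G colour deg≡2 e-at-w f-at-w differ c)) (parity≡true⇒odd refl))
    where
    differ : colour e ≢ colour f
    differ rewrite colour-at e-at-w | colour-at f-at-w = fromBit-≢ (begin
      (a w xor twist e w) xor (a w xor twist f w) ≡⟨ xor-interchange (a w) _ _ _ ⟩
      (a w xor a w) xor (twist e w xor twist f w) ≡⟨ cong₂ _xor_ (xor-same (a w)) (twist-switching (inj₁ (e≢f , e-at-w , f-at-w))) ⟩
      isDeg2 G w                                  ≡⟨ isDeg2-≡2 {G} deg≡2 ⟩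
      true                                        ∎)
      where open ≡-Reasoning

  oddColouring : HasOddColouring G 2
  oddColouring = colour , colour-odd

-- Fewer than two colours

colDeg-oneColour : ∀ G (col : Fin (nE G) → Fin 1) x → colDeg G col zero x ≡ deg G x
colDeg-oneColour G col x = colDeg-monochromatic G col {x} {zero} (λ e _ → only-zero (col e)) zero
  where
  only-zero : (c : Fin 1) → c ≡ zero
  only-zero zero = refl

odd⇒oneColour : ∀ G → IsOdd G → HasOddColouring G 1
odd⇒oneColour G G-odd = (λ _ → zero) , λ { zero w → inj₂ (subst Odd (sym (colDeg-oneColour G (λ _ → zero) w)) (G-odd w)) }

deg2⇒¬fewerColours : ∀ G {v} → deg G v ≡ 2 → ∀ j → j < 2 → ¬ HasOddColouring G j
deg2⇒¬fewerColours G {v} deg≡2 zero _ (col , _)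
  with sumFin-nonzero (λ e → endsAt G e v) (λ deg≡0 → 1+n≢0 (trans (sym deg≡2) deg≡0))
... | e , _ with col e
...   | ()
deg2⇒¬fewerColours G {v} deg≡2 (suc zero) _ (col , odd-col) with odd-col zero v
... | inj₁ colDeg≡0 with trans (sym deg≡2) (trans (sym (colDeg-oneColour G col v)) colDeg≡0)
...   | ()
deg2⇒¬fewerColours G {v} deg≡2 (suc zero) _ (col , odd-col) | inj₂ odd =
  ¬Odd-2 (subst Odd (trans (colDeg-oneColour G col v) deg≡2) odd)
deg2⇒¬fewerColours G deg≡2 (suc (suc j)) (s≤s (s≤s ()))

¬odd⇒deg2 : ∀ G → TwoOrOddDegrees G → ¬ IsOdd G → ∃ λ v → deg G v ≡ 2
¬odd⇒deg2 G degrees not-odd with Finₚ.¬∀⟶∃¬ (nV G) (λ v → Odd (deg G v)) (λ v → ¬? (2 ∣? deg G v)) not-odd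
... | v , not-odd-v with degrees v
...   | inj₁ deg≡2 = v , deg≡2
...   | inj₂ odd   = ⊥-elim (not-odd-v odd)

corollary3p4 : (G : Graph) → InS G →
    (OddChromaticIndex G 2 ⇔
    ((¬ IsOdd G) × ((C : Cycle G) → Even (deg2Count G C))))
corollary3p4 G G∈S = mk⇔ forward backward
  where
  degrees : TwoOrOddDegrees G
  degrees = InS⇒TwoOrOddDegrees G G∈S

  forward : OddChromaticIndex G 2 → ¬ IsOdd G × ((C : Cycle G) → Even (deg2Count G C))
  forward ((col , odd-col) , minimal) =
    (λ G-odd → minimal 1 (s≤s (s≤s z≤n)) (odd⇒oneColour G G-odd)) ,
    oddColouring⇒even-deg2Count G degrees col odd-col

  backward : ¬ IsOdd G × ((C : Cycle G) → Even (deg2Count G C)) → OddChromaticIndex G 2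
  backward (not-odd , even) =
    EvenCycles.oddColouring G degrees even ,
    deg2⇒¬fewerColours G (proj₂ (¬odd⇒deg2 G degrees not-odd))
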